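{- Let $p<q<r$ be primes and $N>1$ an integer whose divisors $1=d_1<d_2<\cdots$ satisfy $d_2=p$, $d_3=q$, $d_4=r$, $d_5=pq$, all in $S'_N$. Suppose $N$ is small recurrent with $U(p,q,a,b)$ for integers $a,b$. Then: (i) $\gcd(a,b)=1$ and $p\nmid a$; (ii) $\gcd(b,d_i)=1$ for all $d_i\in S'_N$; (iii) $\gcd(d_i,d_{i+1})=1$ for all $d_i,d_{i+1}\in S'_N$; (iv) for $d_i\in S'_N$, $p\mid d_i$ if and only if $i\equiv2\pmod3$; (v) for $d_i\in S'_N$, $q\mid d_i$ if and only if $i$ is odd.
   Context: For $N>1$ let $1=d_1<d_2<\cdots<d_{\tau(N)}=N$ be its divisors and $S'_N=\{d:1<d<\sqrt N,\ d\mid N\}=\{d_2,d_3,\ldots\}$. "$N$ is small recurrent with $U(p,q,a,b)$" means $d_2=p$, $d_3=q$ and $d_i=ad_{i-1}+bd_{i-2}$ for every $i\ge4$ with $d_i\in S'_N$. -}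

module Defs where

open import Data.Nat using (ℕ; suc; _∸_; _*_; _<_; _≤_)
open import Data.Nat.Divisibility using (_∣_; _∣?_)
open import Data.Integer using (ℤ; +_) renaming (_+_ to _+ℤ_; _*_ to _*ℤ_)
open import Data.List using (length; filter; applyUpTo)
open import Data.Product using (_×_)
open import Relation.Binary.PropositionalEquality using (_≡_)

divCount : ℕ → ℕ → ℕ
divCount N d = length (filter (λ k → k ∣? N) (applyUpTo suc d))

-- IthDiv N i d : d is the i-th divisor d_i of N (1-indexed, increasing order),
-- i.e. d ∣ N, 1 ≤ d, and exactly i divisors of N lie in [1 .. d].
IthDiv : ℕ → ℕ → ℕ → Set
IthDiv N i d = d ∣ N × 1 ≤ d × divCount N d ≡ i

-- d ∈ S'_N  :  d ∣ N and 1 < d < √N  (the latter written d*d < N)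
InS' : ℕ → ℕ → Set
InS' N d = d ∣ N × 1 < d × d * d < N

SmallRecurrent : ℕ → ℕ → ℕ → ℤ → ℤ → Set
SmallRecurrent N p q a b =
  IthDiv N 2 p × IthDiv N 3 q ×
  (∀ i d d₁ d₂ → 4 ≤ i → IthDiv N i d → InS' N d →
     IthDiv N (i ∸ 1) d₁ → IthDiv N (i ∸ 2) d₂ →
     + d ≡ (a *ℤ + d₁) +ℤ (b *ℤ + d₂))

module Submission where

-- Reading the recurrence at d₄ = r and d₅ = pq, r = aq + bp and pq = ar + bq give q ∣ a, p ∤ a,
-- p ∤ b, gcd(a, b) = 1 and p ∣ a² + b.  For consecutive terms x, y, z = ay + bx, a common divisor
-- of y and z divides bx, hence x once gcd(b, y) = 1, and gcd(b, z) = 1 follows from gcd(a, b) = 1;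
-- so both coprimalities propagate from (d₂, d₃) = (p, q).  Modulo q the recurrence is z ≡ bx with
-- q ∤ b, so q-divisibility alternates.  Modulo p, if p ∣ dᵢ then d_{i+2} ≡ a d_{i+1} and
-- d_{i+3} ≡ (a² + b) d_{i+1} ≡ 0, while p ∤ a, b keeps the two terms in between prime to p.

open import Defs
open import Data.Nat using (ℕ; suc; _*_; _<_; _%_)
open import Data.Nat.Divisibility using (_∣_)
open import Data.Nat.GCD using (gcd)
open import Data.Nat.Primality using (Prime)
open import Data.Integer using (ℤ; +_)
open import Data.Integer.Divisibility using () renaming (_∣_ to _∣ℤ_)
open import Data.Integer.GCD using () renaming (gcd to gcdℤ)
open import Data.Product using (_×_)
open import Function.Bundles using (_⇔_)
open import Relation.Nullary using (¬_)
open import Relation.Binary.PropositionalEquality using (_≡_)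

open import Data.Nat.Base using (zero; _+_; _≤_; _/_; z≤n; s≤s; NonZero; nonTrivial⇒n>1)
open import Data.Nat.Properties
  using (≤-refl; ≤-trans; <-trans; ≤-antisym; ≤-<-trans; <-irrefl; <⇒≤; ≮⇒≥; ≰⇒>; 1+n≰n; n<1+n;
         m≤m+n; +-comm; +-identityʳ; suc-injective; *-mono-≤; m≤n⇒m<n∨m≡n; module ≤-Reasoning)
open import Data.Nat.DivMod using (m≡m%n+[m/n]*n; [m+kn]%n≡m%n)
open import Data.Nat.Divisibility using (_∤_; _∣?_; ∣-refl; ∣-trans; 1∣_; m∣m*n; n∣m*n; >⇒∤)
open import Data.Nat.Coprimality using (Coprime; coprime⇒gcd≡1; coprime-divisor)
  renaming (sym to coprime-sym)
open import Data.Nat.Primality using (prime⇒irreducible; prime⇒nonZero; prime⇒nonTrivial; euclidsLemma)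
open import Data.Integer using (_-_) renaming (_+_ to _+ℤ_; _*_ to _*ℤ_; ∣_∣ to abs)
open import Data.Integer.Properties using (abs-*)
import Data.Integer.Divisibility.Signed as Signed
open import Data.Integer.Tactic.RingSolver using (solve-∀)
open import Data.List using (length; filter; applyUpTo; _++_; [_])
open import Data.List.Properties using (applyUpTo-∷ʳ; filter-++; filter-accept; filter-reject; length-++)
open import Data.Product using (∃-syntax; _,_; proj₁; proj₂)
open import Data.Sum using (_⊎_; inj₁; inj₂; [_,_]′)
open import Data.Empty using (⊥-elim)
open import Function.Base using (id; _∘_)
open import Function.Bundles using (mk⇔)
open import Relation.Nullary using (yes; no)
open import Relation.Binary.PropositionalEquality using (refl; sym; trans; cong; subst; subst₂; module ≡-Reasoning)

divCount-snoc : ∀ N d → divCount N (suc d) ≡ divCount N d + length (filter (_∣? N) [ suc d ])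
divCount-snoc N d = begin
  divCount N (suc d)
    ≡⟨ cong (length ∘ filter (_∣? N)) (applyUpTo-∷ʳ suc d) ⟨
  length (filter (_∣? N) (applyUpTo suc d ++ [ suc d ]))
    ≡⟨ cong length (filter-++ (_∣? N) (applyUpTo suc d) [ suc d ]) ⟩
  length (filter (_∣? N) (applyUpTo suc d) ++ filter (_∣? N) [ suc d ])
    ≡⟨ length-++ (filter (_∣? N) (applyUpTo suc d)) ⟩
  divCount N d + length (filter (_∣? N) [ suc d ]) ∎
  where open ≡-Reasoning

divCount-suc-∣ : ∀ {N d} → suc d ∣ N → divCount N (suc d) ≡ suc (divCount N d)
divCount-suc-∣ {N} {d} h = begin
  divCount N (suc d)                                ≡⟨ divCount-snoc N d ⟩
  divCount N d + length (filter (_∣? N) [ suc d ])  ≡⟨ cong (λ xs → divCount N d + length xs) (filter-accept (_∣? N) h) ⟩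
  divCount N d + 1                                  ≡⟨ +-comm (divCount N d) 1 ⟩
  suc (divCount N d)                                ∎
  where open ≡-Reasoning

divCount-suc-∤ : ∀ {N d} → suc d ∤ N → divCount N (suc d) ≡ divCount N d
divCount-suc-∤ {N} {d} h = begin
  divCount N (suc d)                                ≡⟨ divCount-snoc N d ⟩
  divCount N d + length (filter (_∣? N) [ suc d ])  ≡⟨ cong (λ xs → divCount N d + length xs) (filter-reject (_∣? N) h) ⟩
  divCount N d + 0                                  ≡⟨ +-identityʳ (divCount N d) ⟩
  divCount N d                                      ∎
  where open ≡-Reasoning

divCount-mono : ∀ N {d e} → d ≤ e → divCount N d ≤ divCount N e
divCount-mono N {e = zero} z≤n = ≤-refl
divCount-mono N {d} {suc e} d≤1+e with m≤n⇒m<n∨m≡n d≤1+e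
... | inj₂ refl = ≤-refl
... | inj₁ (s≤s d≤e) = ≤-trans (divCount-mono N d≤e) step
  where
  step : divCount N e ≤ divCount N (suc e)
  step = subst (divCount N e ≤_) (sym (divCount-snoc N e)) (m≤m+n _ _)

divCount-< : ∀ N {d e} → d < e → e ∣ N → divCount N d < divCount N e
divCount-< N {d} {suc e} (s≤s d≤e) h = begin-strict
  divCount N d        ≤⟨ divCount-mono N d≤e ⟩
  divCount N e        <⟨ n<1+n (divCount N e) ⟩
  suc (divCount N e)  ≡⟨ divCount-suc-∣ h ⟨
  divCount N (suc e)  ∎
  where open ≤-Reasoning

IthDiv-1 : ∀ N → IthDiv N 1 1
IthDiv-1 N = 1∣ N , ≤-refl , divCount-suc-∣ (1∣ N)

IthDiv-0 : ∀ {N d} → ¬ IthDiv N 0 d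
IthDiv-0 {N} {d} (_ , 1≤d , c) = 1+n≰n (subst₂ _≤_ (proj₂ (proj₂ (IthDiv-1 N))) c (divCount-mono N 1≤d))

IthDiv-< : ∀ {N i d e} → IthDiv N i d → IthDiv N (suc i) e → d < e
IthDiv-< {N} (_ , _ , c) (_ , _ , c′) = ≰⇒> λ e≤d → 1+n≰n (subst₂ _≤_ c′ c (divCount-mono N e≤d))

IthDiv-unique : ∀ {N i d e} → IthDiv N i d → IthDiv N i e → d ≡ e
IthDiv-unique h h′ = ≤-antisym (≮⇒≥ (not-below h′ h)) (≮⇒≥ (not-below h h′))
  where
  not-below : ∀ {N i u v} → IthDiv N i u → IthDiv N i v → ¬ u < v
  not-below {N} (_ , _ , c) (v∣N , _ , c′) u<v = <-irrefl refl (subst₂ _<_ c c′ (divCount-< N u<v v∣N))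

divCount⇒IthDiv : ∀ N {i} e → divCount N e ≡ suc i → ∃[ d ] IthDiv N (suc i) d
divCount⇒IthDiv N zero ()
divCount⇒IthDiv N (suc e) c with suc e ∣? N
... | yes h = suc e , h , s≤s z≤n , c
... | no h = divCount⇒IthDiv N e (trans (sym (divCount-suc-∤ h)) c)

IthDiv-pred : ∀ {N i d} → IthDiv N (suc (suc i)) d → ∃[ c ] IthDiv N (suc i) c
IthDiv-pred {N} {d = suc e} (d∣N , _ , c) = divCount⇒IthDiv N e (suc-injective (trans (sym (divCount-suc-∣ d∣N)) c))

1<IthDiv : ∀ {N i d} → IthDiv N (suc (suc i)) d → 1 < d
1<IthDiv h with IthDiv-pred h
... | c , hc = ≤-<-trans (proj₁ (proj₂ hc)) (IthDiv-< hc h)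

IthDiv-index : ∀ {N i d} → IthDiv N i d → 1 < d → ∃[ n ] i ≡ 2 + n
IthDiv-index {i = zero} h _ = ⊥-elim (IthDiv-0 h)
IthDiv-index {N} {i = suc zero} h 1<d = ⊥-elim (<-irrefl (IthDiv-unique (IthDiv-1 N) h) 1<d)
IthDiv-index {i = suc (suc n)} _ _ = n , refl

InS'-pred : ∀ {N i x y} → IthDiv N (suc (suc i)) x → IthDiv N (suc (suc (suc i))) y → InS' N y → InS' N x
InS'-pred {x = x} {y} hx hy (_ , _ , y²<N) = proj₁ hx , 1<IthDiv hx , ≤-<-trans (*-mono-≤ x≤y x≤y) y²<N
  where
  x≤y : x ≤ y
  x≤y = <⇒≤ (IthDiv-< hx hy)

-- + k ∣ℤ m unfolds to k ∣ ∣ m ∣, so these are the signed lemmas transported along that reading;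
-- m and n are explicit because ∣_∣ is not injective.
∣m∣n⇒∣m+n : ∀ {k} m n → + k ∣ℤ m → + k ∣ℤ n → + k ∣ℤ m +ℤ n
∣m∣n⇒∣m+n {k} m n k∣m k∣n =
  Signed.∣⇒∣ᵤ {+ k} {m +ℤ n} (Signed.∣m∣n⇒∣m+n (Signed.∣ᵤ⇒∣ {+ k} {m} k∣m) (Signed.∣ᵤ⇒∣ {+ k} {n} k∣n))

∣m∣n⇒∣m-n : ∀ {k} m n → + k ∣ℤ m → + k ∣ℤ n → + k ∣ℤ m - n
∣m∣n⇒∣m-n {k} m n k∣m k∣n =
  Signed.∣⇒∣ᵤ {+ k} {m - n} (Signed.∣m∣n⇒∣m-n (Signed.∣ᵤ⇒∣ {+ k} {m} k∣m) (Signed.∣ᵤ⇒∣ {+ k} {n} k∣n))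

∣m+n∣m⇒∣n : ∀ {k} m n → + k ∣ℤ m +ℤ n → + k ∣ℤ m → + k ∣ℤ n
∣m+n∣m⇒∣n {k} m n k∣m+n k∣m =
  Signed.∣⇒∣ᵤ {+ k} {n} (Signed.∣m+n∣m⇒∣n (Signed.∣ᵤ⇒∣ {+ k} {m +ℤ n} k∣m+n) (Signed.∣ᵤ⇒∣ {+ k} {m} k∣m))

∣m+n∣n⇒∣m : ∀ {k} m n → + k ∣ℤ m +ℤ n → + k ∣ℤ n → + k ∣ℤ m
∣m+n∣n⇒∣m {k} m n k∣m+n k∣n =
  Signed.∣⇒∣ᵤ {+ k} {m} (Signed.∣m+n∣n⇒∣m (Signed.∣ᵤ⇒∣ {+ k} {m +ℤ n} k∣m+n) (Signed.∣ᵤ⇒∣ {+ k} {n} k∣n))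

∣n⇒∣m*n : ∀ {k} m n → + k ∣ℤ n → + k ∣ℤ m *ℤ n
∣n⇒∣m*n {k} m n k∣n = Signed.∣⇒∣ᵤ {+ k} {m *ℤ n} (Signed.∣n⇒∣m*n m (Signed.∣ᵤ⇒∣ {+ k} {n} k∣n))

∣m⇒∣m*n : ∀ {k} m n → + k ∣ℤ m → + k ∣ℤ m *ℤ n
∣m⇒∣m*n {k} m n k∣m = Signed.∣⇒∣ᵤ {+ k} {m *ℤ n} (Signed.∣m⇒∣m*n n (Signed.∣ᵤ⇒∣ {+ k} {m} k∣m))

euclidsLemmaℤ : ∀ {p} m n → Prime p → + p ∣ℤ m *ℤ n → + p ∣ℤ m ⊎ + p ∣ℤ n
euclidsLemmaℤ {p} m n pp p∣mn = euclidsLemma (abs m) (abs n) pp (subst (p ∣_) (abs-* m n) p∣mn)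

prime∣*∤ʳ⇒∣ˡ : ∀ {p} m n → Prime p → + p ∣ℤ m *ℤ n → ¬ + p ∣ℤ n → + p ∣ℤ m
prime∣*∤ʳ⇒∣ˡ m n pp p∣mn p∤n = [ id , ⊥-elim ∘ p∤n ]′ (euclidsLemmaℤ m n pp p∣mn)

coprime-divisorℤ : ∀ {k} m n → Coprime k (abs m) → + k ∣ℤ m *ℤ n → + k ∣ℤ n
coprime-divisorℤ {k} m n k⊥m k∣mn = coprime-divisor k⊥m (subst (k ∣_) (abs-* m n) k∣mn)

prime⇒1< : ∀ {p} → Prime p → 1 < p
prime⇒1< {p} pp = nonTrivial⇒n>1 p {{prime⇒nonTrivial pp}}

prime∤⇒coprime : ∀ {p n} → Prime p → p ∤ n → Coprime p n
prime∤⇒coprime pp p∤n {d} (d∣p , d∣n) with prime⇒irreducible pp d∣p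
... | inj₁ d≡1 = d≡1
... | inj₂ refl = ⊥-elim (p∤n d∣n)

<prime⇒∤ : ∀ {m p} → Prime p → 1 < m → m < p → m ∤ p
<prime⇒∤ pp 1<m m<p m∣p with prime⇒irreducible pp m∣p
... | inj₁ refl = <-irrefl refl 1<m
... | inj₂ refl = <-irrefl refl m<p

coprime-∣ʳ : ∀ {m n d} → Coprime m n → d ∣ n → Coprime m d
coprime-∣ʳ m⊥n d∣n (c∣m , c∣d) = m⊥n (c∣m , ∣-trans c∣d d∣n)

record Recurs (a b : ℤ) (x y z : ℕ) : Set where
  constructor recurs
  field z≡ay+bx : + z ≡ a *ℤ + y +ℤ b *ℤ + x

module _ {a b x y z} (step : Recurs a b x y z) {k : ℕ} where
  open Recurs step

  recurs-∣ : + k ∣ℤ a *ℤ + y → + k ∣ℤ b *ℤ + x → k ∣ z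
  recurs-∣ k∣ay k∣bx = subst (+ k ∣ℤ_) (sym z≡ay+bx) (∣m∣n⇒∣m+n (a *ℤ + y) (b *ℤ + x) k∣ay k∣bx)

  recurs-∣-bx : k ∣ z → + k ∣ℤ a *ℤ + y → + k ∣ℤ b *ℤ + x
  recurs-∣-bx k∣z = ∣m+n∣m⇒∣n (a *ℤ + y) (b *ℤ + x) (subst (+ k ∣ℤ_) z≡ay+bx k∣z)

  recurs-∣-ay : k ∣ z → + k ∣ℤ b *ℤ + x → + k ∣ℤ a *ℤ + y
  recurs-∣-ay k∣z = ∣m+n∣n⇒∣m (a *ℤ + y) (b *ℤ + x) (subst (+ k ∣ℤ_) z≡ay+bx k∣z)

coprime-step : ∀ {a b x y z} → Recurs a b x y z → Coprime (abs b) y → Coprime x y → Coprime y z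
coprime-step {a} {b} {x} {y} step b⊥y x⊥y {k} (k∣y , k∣z) = x⊥y (k∣x , k∣y)
  where
  k⊥b : Coprime k (abs b)
  k⊥b = coprime-sym (coprime-∣ʳ b⊥y k∣y)
  k∣x : k ∣ x
  k∣x = coprime-divisorℤ b (+ x) k⊥b (recurs-∣-bx step k∣z (∣n⇒∣m*n a (+ y) k∣y))

coprime-b-step : ∀ {a b x y z} → Recurs a b x y z → Coprime (abs a) (abs b) → Coprime (abs b) y → Coprime (abs b) z
coprime-b-step {a} {b} {x} {y} step a⊥b b⊥y {k} (k∣b , k∣z) = b⊥y (k∣b , k∣y)
  where
  k⊥a : Coprime k (abs a)
  k⊥a = coprime-sym (coprime-∣ʳ a⊥b k∣b)
  k∣y : k ∣ y
  k∣y = coprime-divisorℤ a (+ y) k⊥a (recurs-∣-ay step k∣z (∣m⇒∣m*n b (+ x) k∣b))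

data QParity (q x y : ℕ) : ℕ → Set where
  divides-x : q ∣ x → q ∤ y → QParity q x y 0
  divides-y : q ∣ y → q ∤ x → QParity q x y 1

qParity-step : ∀ {q a b x y z k} → Prime q → + q ∣ℤ a → ¬ + q ∣ℤ b →
               Recurs a b x y z → QParity q x y k → QParity q y z (suc k % 2)
qParity-step {a = a} {b} {x} {y} pq q∣a q∤b step (divides-x q∣x q∤y) =
  divides-y (recurs-∣ step (∣m⇒∣m*n a (+ y) q∣a) (∣n⇒∣m*n b (+ x) q∣x)) q∤y
qParity-step {q} {a} {b} {x} {y} {z} pq q∣a q∤b step (divides-y q∣y q∤x) = divides-x q∣y q∤z
  where
  q∤z : q ∤ z
  q∤z q∣z = [ q∤b , q∤x ]′ (euclidsLemmaℤ b (+ x) pq (recurs-∣-bx step q∣z (∣m⇒∣m*n a (+ y) q∣a)))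

QParity-∣⇔ : ∀ {q x y k} → QParity q x y k → (q ∣ y ⇔ k ≡ 1)
QParity-∣⇔ (divides-x _ q∤y) = mk⇔ (⊥-elim ∘ q∤y) λ ()
QParity-∣⇔ (divides-y q∣y _) = mk⇔ (λ _ → refl) (λ _ → q∣y)

-- In the phase where p divides neither term, y ≡ a x (mod p) is what forces p ∣ z.
data PPhase (p : ℕ) (a : ℤ) (x y : ℕ) : ℕ → Set where
  divides-x       : p ∣ x → p ∤ y → PPhase p a x y 0
  divides-neither : p ∤ x → p ∤ y → + p ∣ℤ + y - a *ℤ + x → PPhase p a x y 1
  divides-y       : p ∣ y → p ∤ x → PPhase p a x y 2

pPhase-step : ∀ {p a b x y z k} → Prime p → ¬ + p ∣ℤ a → ¬ + p ∣ℤ b → + p ∣ℤ a *ℤ a +ℤ b →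
              Recurs a b x y z → PPhase p a x y k → PPhase p a y z (suc k % 3)
pPhase-step {p} {a} {b} {x} {y} {z} pp p∤a p∤b p∣a²+b step (divides-x p∣x p∤y) =
  divides-neither p∤y p∤z (subst (+ p ∣ℤ_) (sym z-ay≡bx) (∣n⇒∣m*n b (+ x) p∣x))
  where
  open Recurs step
  z-ay≡bx : + z - a *ℤ + y ≡ b *ℤ + x
  z-ay≡bx = trans (cong (_- a *ℤ + y) z≡ay+bx) (cancel a b (+ x) (+ y))
    where
    cancel : ∀ a b x y → a *ℤ y +ℤ b *ℤ x - a *ℤ y ≡ b *ℤ x
    cancel = solve-∀
  p∤z : p ∤ z
  p∤z p∣z = [ p∤a , p∤y ]′ (euclidsLemmaℤ a (+ y) pp (recurs-∣-ay step p∣z (∣n⇒∣m*n b (+ x) p∣x)))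
pPhase-step {p} {a} {b} {x} {y} {z} pp p∤a p∤b p∣a²+b step (divides-neither p∤x p∤y p∣y-ax) =
  divides-y p∣z p∤y
  where
  open Recurs step
  regroup : ∀ a b x y → a *ℤ y +ℤ b *ℤ x ≡ a *ℤ (y - a *ℤ x) +ℤ (a *ℤ a +ℤ b) *ℤ x
  regroup = solve-∀
  p∣z : p ∣ z
  p∣z = subst (+ p ∣ℤ_) (sym (trans z≡ay+bx (regroup a b (+ x) (+ y))))
          (∣m∣n⇒∣m+n (a *ℤ (+ y - a *ℤ + x)) ((a *ℤ a +ℤ b) *ℤ + x)
            (∣n⇒∣m*n a (+ y - a *ℤ + x) p∣y-ax) (∣m⇒∣m*n (a *ℤ a +ℤ b) (+ x) p∣a²+b))
pPhase-step {p} {a} {b} {x} {y} {z} pp p∤a p∤b p∣a²+b step (divides-y p∣y p∤x) = divides-x p∣y p∤z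
  where
  p∤z : p ∤ z
  p∤z p∣z = [ p∤b , p∤x ]′ (euclidsLemmaℤ b (+ x) pp (recurs-∣-bx step p∣z (∣n⇒∣m*n a (+ y) p∣y)))

PPhase-∣⇔ : ∀ {p a x y k} → PPhase p a x y k → (p ∣ y ⇔ k ≡ 2)
PPhase-∣⇔ (divides-x _ p∤y)         = mk⇔ (⊥-elim ∘ p∤y) λ ()
PPhase-∣⇔ (divides-neither _ p∤y _) = mk⇔ (⊥-elim ∘ p∤y) λ ()
PPhase-∣⇔ (divides-y p∣y _)         = mk⇔ (λ _ → refl) (λ _ → p∣y)

suc-% : ∀ n m .{{_ : NonZero m}} → suc n % m ≡ suc (n % m) % m
suc-% n m = begin
  suc n % m                    ≡⟨ cong (λ t → suc t % m) (m≡m%n+[m/n]*n n m) ⟩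
  suc (n % m + n / m * m) % m  ≡⟨ [m+kn]%n≡m%n (suc (n % m)) (n / m) m ⟩
  suc (n % m) % m              ∎
  where open ≡-Reasoning

record Admissible (p q : ℕ) (a b : ℤ) : Set where
  field
    prime-p : Prime p
    prime-q : Prime q
    p∤q     : p ∤ q
    q∤p     : q ∤ p
    q∣a     : + q ∣ℤ a
    p∤a     : ¬ + p ∣ℤ a
    p∤b     : ¬ + p ∣ℤ b
    q∤b     : ¬ + q ∣ℤ b
    p∣a²+b  : + p ∣ℤ a *ℤ a +ℤ b
    a⊥b     : Coprime (abs a) (abs b)

-- i is the index of y, so p-phase and q-parity record i modulo 3 and modulo 2.
record PairState (p q : ℕ) (a b : ℤ) (i x y : ℕ) : Set where
  field
    x⊥y      : Coprime x y
    b⊥y      : Coprime (abs b) y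
    p-phase  : PPhase p a x y (i % 3)
    q-parity : QParity q x y (i % 2)

pairState-step : ∀ {p q a b i x y z} → Admissible p q a b → Recurs a b x y z →
                 PairState p q a b i x y → PairState p q a b (suc i) y z
pairState-step {i = i} adm step s = record
  { x⊥y      = coprime-step step b⊥y x⊥y
  ; b⊥y      = coprime-b-step step a⊥b b⊥y
  ; p-phase  = subst (PPhase _ _ _ _) (sym (suc-% i 3)) (pPhase-step prime-p p∤a p∤b p∣a²+b step p-phase)
  ; q-parity = subst (QParity _ _ _) (sym (suc-% i 2)) (qParity-step prime-q q∣a q∤b step q-parity)
  }
  where
  open Admissible adm
  open PairState s

module FirstTerms {p q r : ℕ} {a b : ℤ} (pp : Prime p) (pq : Prime q) (pr : Prime r) (p<q : p < q) (q<r : q < r)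
                  (d₄ : Recurs a b p q r) (d₅ : Recurs a b q r (p * q)) where

  p∤q : p ∤ q
  p∤q = <prime⇒∤ pq (prime⇒1< pp) p<q

  p∤r : p ∤ r
  p∤r = <prime⇒∤ pr (prime⇒1< pp) (<-trans p<q q<r)

  q∤r : q ∤ r
  q∤r = <prime⇒∤ pr (prime⇒1< pq) q<r

  r∤pq : r ∤ p * q
  r∤pq r∣pq = [ >⇒∤ {{prime⇒nonZero pp}} (<-trans p<q q<r) , >⇒∤ {{prime⇒nonZero pq}} q<r ]′ (euclidsLemma p q pr r∣pq)

  q∣a : + q ∣ℤ a
  q∣a = prime∣*∤ʳ⇒∣ˡ a (+ r) pq (recurs-∣-ay d₅ (n∣m*n p) (∣n⇒∣m*n b (+ q) ∣-refl)) q∤r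

  a⊥b : Coprime (abs a) (abs b)
  a⊥b {k} (k∣a , k∣b) with prime⇒irreducible pr (recurs-∣ d₄ (∣m⇒∣m*n a (+ q) k∣a) (∣m⇒∣m*n b (+ p) k∣b))
  ... | inj₁ k≡1 = k≡1
  ... | inj₂ refl = ⊥-elim (r∤pq (recurs-∣ d₅ (∣m⇒∣m*n a (+ r) k∣a) (∣m⇒∣m*n b (+ q) k∣b)))

  p∤a : ¬ + p ∣ℤ a
  p∤a p∣a = p∤r (recurs-∣ d₄ (∣m⇒∣m*n a (+ q) p∣a) (∣m⇒∣m*n b (+ p) p∣b))
    where
    p∣b : + p ∣ℤ b
    p∣b = prime∣*∤ʳ⇒∣ˡ b (+ q) pp (recurs-∣-bx d₅ (m∣m*n q) (∣m⇒∣m*n a (+ r) p∣a)) p∤q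

  p∤b : ¬ + p ∣ℤ b
  p∤b p∣b = [ p∤a , p∤r ]′ (euclidsLemmaℤ a (+ r) pp (recurs-∣-ay d₅ (m∣m*n q) (∣m⇒∣m*n b (+ q) p∣b)))

  q∤b : ¬ + q ∣ℤ b
  q∤b q∣b = <-irrefl (sym (a⊥b (q∣a , q∣b))) (prime⇒1< pq)

  -- (a² + b) q = a (a q + b p) + b q - a b p = a r + b q - a b p = p q - a b p.
  p∣a²+b : + p ∣ℤ a *ℤ a +ℤ b
  p∣a²+b = prime∣*∤ʳ⇒∣ˡ (a *ℤ a +ℤ b) (+ q) pp (subst (+ p ∣ℤ_) (sym expand) p∣pq-abp) p∤q
    where
    regroup : ∀ a b p q → (a *ℤ a +ℤ b) *ℤ q ≡ a *ℤ (a *ℤ q +ℤ b *ℤ p) +ℤ b *ℤ q - a *ℤ (b *ℤ p)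
    regroup = solve-∀
    expand : (a *ℤ a +ℤ b) *ℤ + q ≡ + (p * q) - a *ℤ (b *ℤ + p)
    expand = begin
      (a *ℤ a +ℤ b) *ℤ + q                                         ≡⟨ regroup a b (+ p) (+ q) ⟩
      a *ℤ (a *ℤ + q +ℤ b *ℤ + p) +ℤ b *ℤ + q - a *ℤ (b *ℤ + p)   ≡⟨ cong (λ t → a *ℤ t +ℤ b *ℤ + q - a *ℤ (b *ℤ + p)) (sym (Recurs.z≡ay+bx d₄)) ⟩
      a *ℤ + r +ℤ b *ℤ + q - a *ℤ (b *ℤ + p)                       ≡⟨ cong (_- a *ℤ (b *ℤ + p)) (sym (Recurs.z≡ay+bx d₅)) ⟩
      + (p * q) - a *ℤ (b *ℤ + p)                                   ∎
      where open ≡-Reasoning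
    p∣pq-abp : + p ∣ℤ + (p * q) - a *ℤ (b *ℤ + p)
    p∣pq-abp = ∣m∣n⇒∣m-n (+ (p * q)) (a *ℤ (b *ℤ + p)) (m∣m*n q) (∣n⇒∣m*n a (b *ℤ + p) (∣n⇒∣m*n b (+ p) ∣-refl))

  admissible : Admissible p q a b
  admissible = record
    { prime-p = pp ; prime-q = pq ; p∤q = p∤q ; q∤p = >⇒∤ {{prime⇒nonZero pp}} p<q
    ; q∣a = q∣a ; p∤a = p∤a ; p∤b = p∤b ; q∤b = q∤b ; p∣a²+b = p∣a²+b ; a⊥b = a⊥b }

module SmallDivisors {N p q : ℕ} {a b : ℤ} (adm : Admissible p q a b) (rec : SmallRecurrent N p q a b) where
  open Admissible adm

  d₂ : IthDiv N 2 p
  d₂ = proj₁ rec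

  d₃ : IthDiv N 3 q
  d₃ = proj₁ (proj₂ rec)

  recurs-at : ∀ n {w x y} → IthDiv N (2 + n) w → IthDiv N (3 + n) x → IthDiv N (4 + n) y → InS' N y → Recurs a b w x y
  recurs-at n {w} {x} {y} hw hx hy sy = recurs (proj₂ (proj₂ rec) (4 + n) y x w (m≤m+n 4 n) hy sy hx hw)

  pairState : ∀ n {x y} → IthDiv N (2 + n) x → IthDiv N (3 + n) y → InS' N y → PairState p q a b (3 + n) x y
  pairState zero hx hy _ with IthDiv-unique hx d₂ | IthDiv-unique hy d₃
  ... | refl | refl = record
    { x⊥y      = prime∤⇒coprime prime-p p∤q
    ; b⊥y      = coprime-sym (prime∤⇒coprime prime-q q∤b)
    ; p-phase  = divides-x ∣-refl p∤q
    ; q-parity = divides-y ∣-refl q∤p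
    }
  pairState (suc n) hx hy sy with IthDiv-pred hx
  ... | w , hw = pairState-step adm (recurs-at n hw hx hy sy) (pairState n hw hx (InS'-pred hx hy sy))

  S'-state : ∀ {i d} → IthDiv N i d → InS' N d → (i ≡ 2 × d ≡ p) ⊎ ∃[ x ] PairState p q a b i x d
  S'-state h s with IthDiv-index h (proj₁ (proj₂ s))
  ... | zero , refl = inj₁ (refl , IthDiv-unique h d₂)
  ... | suc n , refl with IthDiv-pred h
  ...   | x , hx = inj₂ (x , pairState n hx h s)

  b⊥S' : ∀ {i d} → IthDiv N i d → InS' N d → Coprime (abs b) d
  b⊥S' h s with S'-state h s
  ... | inj₁ (refl , refl) = coprime-sym (prime∤⇒coprime prime-p p∤b)
  ... | inj₂ (_ , st) = PairState.b⊥y st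

  p∣S'⇔ : ∀ {i d} → IthDiv N i d → InS' N d → (p ∣ d ⇔ i % 3 ≡ 2)
  p∣S'⇔ h s with S'-state h s
  ... | inj₁ (refl , refl) = mk⇔ (λ _ → refl) (λ _ → ∣-refl)
  ... | inj₂ (_ , st) = PPhase-∣⇔ (PairState.p-phase st)

  q∣S'⇔ : ∀ {i d} → IthDiv N i d → InS' N d → (q ∣ d ⇔ i % 2 ≡ 1)
  q∣S'⇔ h s with S'-state h s
  ... | inj₁ (refl , refl) = mk⇔ (⊥-elim ∘ q∤p) λ ()
  ... | inj₂ (_ , st) = QParity-∣⇔ (PairState.q-parity st)

  S'-consecutive-coprime : ∀ {i d d′} → IthDiv N i d → IthDiv N (suc i) d′ → InS' N d → InS' N d′ → Coprime d d′
  S'-consecutive-coprime h h′ s s′ with IthDiv-index h (proj₁ (proj₂ s))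
  ... | n , refl = PairState.x⊥y (pairState n h h′ s′)

lemma2p5 : (p q r N : ℕ) (a b : ℤ) →
    Prime p → Prime q → Prime r → p < q → q < r → 1 < N →
    IthDiv N 2 p → IthDiv N 3 q → IthDiv N 4 r → IthDiv N 5 (p * q) →
    InS' N p → InS' N q → InS' N r → InS' N (p * q) →
    SmallRecurrent N p q a b →
    (gcdℤ a b ≡ + 1 × ¬ (+ p ∣ℤ a))
    × (∀ i d → IthDiv N i d → InS' N d → gcdℤ b (+ d) ≡ + 1)
    × (∀ i d d′ → IthDiv N i d → IthDiv N (suc i) d′ → InS' N d → InS' N d′ → gcd d d′ ≡ 1)
    × (∀ i d → IthDiv N i d → InS' N d → (p ∣ d ⇔ i % 3 ≡ 2))
    × (∀ i d → IthDiv N i d → InS' N d → (q ∣ d ⇔ i % 2 ≡ 1))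
lemma2p5 p q r N a b pp pq pr p<q q<r _ d₂ d₃ d₄ d₅ _ _ r∈S' pq∈S' small-rec@(_ , _ , recurrence) =
    (cong +_ (coprime⇒gcd≡1 a⊥b) , p∤a)
  , (λ _ _ h s → cong +_ (coprime⇒gcd≡1 (b⊥S' h s)))
  , (λ _ _ _ h h′ s s′ → coprime⇒gcd≡1 (S'-consecutive-coprime h h′ s s′))
  , (λ _ _ → p∣S'⇔)
  , (λ _ _ → q∣S'⇔)
  where
  adm : Admissible p q a b
  adm = FirstTerms.admissible pp pq pr p<q q<r
          (recurs (recurrence 4 r q p ≤-refl d₄ r∈S' d₃ d₂))
          (recurs (recurrence 5 (p * q) r q (m≤m+n 4 1) d₅ pq∈S' d₄ d₃))
  open Admissible adm using (a⊥b; p∤a)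
  open SmallDivisors adm small-rec using (b⊥S'; S'-consecutive-coprime; p∣S'⇔; q∣S'⇔)
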